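{- Let $p$ be an odd prime, $K$ a finite extension of $\mathbb{Q}_p$, and $L/K$ a degree $p$ extension whose normal closure $\widetilde L$ has Galois group over $K$ dihedral of order $2p$, with $\widetilde L/K$ totally ramified. Let $t$ be its ramification jump, $\ell=\frac{p+t}{2}$, $a$ the remainder of $\ell$ modulo $p$, $a_0=\lfloor\ell/p\rfloor$, assume $a\neq0$, and define $\nu_i=\lfloor\frac{a+i\ell}{p}\rfloor$ and $n_i=\min_{0\le j\le p-1-i}(\nu_{i+j}-\nu_j)$ for $0\le i\le p-1$. Let $E=\{h\in\mathbb{Z}: 1\le h<p,\ \widehat{h'\frac{a}{p}}>\widehat{h\frac{a}{p}}\text{ for all integers }1\le h'<h\}$. Then for every $0\le i\le p-1$, $n_i=ia_0+\lfloor i\frac{a}{p}\rfloor+\epsilon$, where $\epsilon=1$ if $p-i\in E$ and $\epsilon=0$ if $p-i\notin E$.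
   Context: For a real number $x$, $\widehat{x}=x-\lfloor x\rfloor$ denotes its fractional part. The ramification jump $t$ of $\widetilde L/K$ is the integer with $G_t$ of order $p$ and $G_{t+1}$ trivial; it is odd, so $\ell$ is an integer. -}

module Defs where

open import Data.Nat using (ℕ; zero; suc; _+_; _*_; _∸_; _/_; _%_; _≤_; _<_; NonZero)
open import Data.Integer using (ℤ; +_; _-_; _⊓_)
open import Data.List using (List; foldr; map; upTo)

module _ (p : ℕ) .{{_ : NonZero p}} (ℓ : ℕ) where

  a : ℕ
  a = ℓ % p

  a₀ : ℕ
  a₀ = ℓ / p

  ν : ℕ → ℕ
  ν i = (a + i * ℓ) / p

  -- n_i = min_{0 ≤ j ≤ p-1-i} (ν_{i+j} - ν_j), computed in ℤ.
  -- (the j = 0 term is used as the seed of the fold; min is idempotent)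
  nn : ℕ → ℤ
  nn i = foldr _⊓_ (d 0) (map d (upTo (p ∸ i)))
    where
    d : ℕ → ℤ
    d j = + ν (i + j) - + ν j

  -- fractional part of h·a/p equals ((h·a) mod p)/p, so comparing fractional
  -- parts amounts to comparing (h·a) mod p.
  -- E = { h : 1 ≤ h < p, frac(h' a/p) > frac(h a/p) for all 1 ≤ h' < h }
  InE : ℕ → Set
  InE h = (1 ≤ h) × (h < p) × (∀ h′ → 1 ≤ h′ → h′ < h → (h * a) % p < (h′ * a) % p)
    where open import Data.Product using (_×_)

module Submission where

-- Writing ℓ = a + a₀ p gives ν_j = j a₀ + ⌊(j+1) a / p⌋, so ν_{i+j} − ν_j = i a₀ + ⌊i a / p⌋ + c,
-- where the carry c ∈ {0, 1} is 1 exactly when r_i + r_{j+1} ≥ p for the residues r_m = (m a) mod p.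
-- As p is prime and p ∤ a, the r_m with 0 < m < p are distinct and nonzero, and r_i + r_{p−i} = p.
-- So every carry with 1 ≤ j + 1 ≤ p − i is 1 precisely when r_{p−i} lies below all earlier r_m,
-- which is p − i ∈ E; otherwise some carry vanishes and the minimum drops by one.

open import Defs
open import Data.Nat using (ℕ; zero; suc; _+_; _*_; _∸_; _/_; _%_; _≤_; _<_; _≤?_; NonZero; >-nonZero; z≤n; s≤s; z<s)
open import Data.Nat.Properties
open import Data.Nat.DivMod
open import Data.Nat.Divisibility using (_∣_; _∤_; divides; divides-refl; m%n≡0⇒n∣m; >⇒∤)
open import Data.Nat.Primality using (Prime; euclidsLemma)
open import Data.Nat.Solver using (module +-*-Solver)
open import Data.Integer using (ℤ; +_; _-_; _⊓_; _⊖_; +≤+) renaming (_≤_ to _≤ℤ_)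
import Data.Integer.Properties as ℤ
open import Data.List using (List; foldr; map; upTo)
open import Data.List.Properties using (foldr-preservesᵇ; foldr-preservesᵒ)
open import Data.List.Relation.Unary.All as All using (All)
open import Data.List.Relation.Unary.Any as Any using (Any)
import Data.List.Relation.Unary.All.Properties as All
import Data.List.Relation.Unary.Any.Properties as Any
open import Data.Product using (_×_; ∃; _,_)
open import Data.Sum using (inj₁; inj₂; [_,_])
open import Relation.Nullary using (¬_; Dec; yes; no; contradiction)
open import Relation.Nullary.Decidable using (_×-dec_)
open import Relation.Binary.PropositionalEquality hiding ([_])
open +-*-Solver

foldr-⊓-attains : ∀ {A : Set} (f : A → ℤ) {v s : ℤ} (xs : List A) →
  v ≤ℤ s → All (λ x → v ≤ℤ f x) xs → Any (λ x → f x ≡ v) xs →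
  foldr _⊓_ s (map f xs) ≡ v
foldr-⊓-attains f {v} xs v≤s lower attained = ℤ.≤-antisym
  (foldr-preservesᵒ {P = _≤ℤ v} {f = _⊓_} (λ x y → [ ℤ.i≤j⇒i⊓k≤j y , ℤ.i≤j⇒k⊓i≤j x ]) _ (map f xs)
    (inj₂ (Any.map⁺ (Any.map ℤ.≤-reflexive attained))))
  (foldr-preservesᵇ {P = v ≤ℤ_} {f = _⊓_} ℤ.⊓-glb v≤s (All.map⁺ lower))

module _ (p : ℕ) .{{_ : NonZero p}} where
  open ≡-Reasoning

  carry : ℕ → ℕ → ℕ
  carry x y = (x % p + y % p) / p

  [m+k*p]/p≡m/p+k : ∀ m k → (m + k * p) / p ≡ m / p + k
  [m+k*p]/p≡m/p+k m k = trans (+-distrib-/-∣ʳ m (divides-refl k)) (cong (_+_ (m / p)) (m*n/n≡m k p))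

  /-distrib-+-carry : ∀ x y → (x + y) / p ≡ x / p + y / p + carry x y
  /-distrib-+-carry x y = begin
      (x + y) / p
    ≡⟨ cong (_/ p) split ⟩
      ((x % p + y % p) + (x / p + y / p) * p) / p
    ≡⟨ [m+k*p]/p≡m/p+k (x % p + y % p) (x / p + y / p) ⟩
      carry x y + (x / p + y / p)
    ≡⟨ +-comm (carry x y) _ ⟩
      x / p + y / p + carry x y ∎
    where
    split : x + y ≡ (x % p + y % p) + (x / p + y / p) * p
    split = trans (cong₂ _+_ (m≡m%n+[m/n]*n x p) (m≡m%n+[m/n]*n y p))
      (solve 5 (λ u v w z P → (u :+ v :* P) :+ (w :+ z :* P) := (u :+ w) :+ (v :+ z) :* P)
        refl (x % p) (x / p) (y % p) (y / p) p)

  carry≡1 : ∀ x y → p ≤ x % p + y % p → carry x y ≡ 1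
  carry≡1 x y p≤ = trans (m/n≡1+[m∸n]/n p≤)
    (cong suc (m<n⇒m/n≡0 (m<n+o⇒m∸n<o _ p (+-mono-< (m%n<n x p) (m%n<n y p)))))

  carry≡0 : ∀ x y → x % p + y % p < p → carry x y ≡ 0
  carry≡0 x y = m<n⇒m/n≡0

  %-≡⇒∣∸ : ∀ x y → x % p ≡ y % p → p ∣ x ∸ y
  %-≡⇒∣∸ x y eq = divides (x / p ∸ y / p) (begin
      x ∸ y
    ≡⟨ cong₂ _∸_ (m≡m%n+[m/n]*n x p) (m≡m%n+[m/n]*n y p) ⟩
      (x % p + x / p * p) ∸ (y % p + y / p * p)
    ≡⟨ cong (λ z → (z + x / p * p) ∸ (y % p + y / p * p)) eq ⟩
      (y % p + x / p * p) ∸ (y % p + y / p * p)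
    ≡⟨ [m+n]∸[m+o]≡n∸o (y % p) (x / p * p) (y / p * p) ⟩
      x / p * p ∸ y / p * p
    ≡⟨ *-distribʳ-∸ p (x / p) (y / p) ⟨
      (x / p ∸ y / p) * p ∎)

0<m<n⇒n∤m : ∀ {m n} → 0 < m → m < n → n ∤ m
0<m<n⇒n∤m 0<m = >⇒∤ {{>-nonZero 0<m}}

module MultiplesModPrime (p : ℕ) .{{_ : NonZero p}} (p-prime : Prime p) (a : ℕ) (p∤a : p ∤ a) where

  [h*a]%p≢0 : ∀ {h} → 0 < h → h < p → (h * a) % p ≢ 0
  [h*a]%p≢0 {h} 0<h h<p eq with euclidsLemma h a p-prime (m%n≡0⇒n∣m _ p eq)
  ... | inj₁ p∣h = 0<m<n⇒n∤m 0<h h<p p∣h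
  ... | inj₂ p∣a = p∤a p∣a

  [m*a]%p≢[h*a]%p : ∀ {m h} → m < h → h < p → (m * a) % p ≢ (h * a) % p
  [m*a]%p≢[h*a]%p {m} {h} m<h h<p eq
    with euclidsLemma (h ∸ m) a p-prime
           (subst (p ∣_) (sym (*-distribʳ-∸ a h m)) (%-≡⇒∣∸ p (h * a) (m * a) (sym eq)))
  ... | inj₁ p∣h∸m = 0<m<n⇒n∤m (m<n⇒0<n∸m m<h) (≤-<-trans (m∸n≤m h m) h<p) p∣h∸m
  ... | inj₂ p∣a = p∤a p∣a

  -- The sum is ≡ (i + h) a ≡ 0 mod p and lies strictly between 0 and 2p.
  [i*a]%p+[h*a]%p≡p : ∀ {i h} → i + h ≡ p → 0 < h → h < p → (i * a) % p + (h * a) % p ≡ p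
  [i*a]%p+[h*a]%p≡p {i} {h} i+h≡p 0<h h<p = multiple (m%n≡0⇒n∣m _ p sum%p≡0)
    where
    open ≡-Reasoning
    sum%p≡0 : ((i * a) % p + (h * a) % p) % p ≡ 0
    sum%p≡0 = begin
        ((i * a) % p + (h * a) % p) % p
      ≡⟨ %-distribˡ-+ (i * a) (h * a) p ⟨
        (i * a + h * a) % p
      ≡⟨ cong (_% p) (*-distribʳ-+ a i h) ⟨
        ((i + h) * a) % p
      ≡⟨ cong (λ z → (z * a) % p) i+h≡p ⟩
        (p * a) % p
      ≡⟨ cong (_% p) (*-comm p a) ⟩
        (a * p) % p
      ≡⟨ m*n%n≡0 a p ⟩
        0 ∎
    multiple : p ∣ (i * a) % p + (h * a) % p → (i * a) % p + (h * a) % p ≡ p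
    multiple (divides zero eq) = contradiction (m+n≡0⇒n≡0 _ eq) ([h*a]%p≢0 0<h h<p)
    multiple (divides (suc zero) eq) = trans eq (+-identityʳ p)
    multiple (divides (suc (suc k)) eq) = contradiction
      (subst (p + p ≤_) (sym eq) (+-monoʳ-≤ p (m≤m+n p (k * p))))
      (<⇒≱ (+-mono-< (m%n<n (i * a) p) (m%n<n (h * a) p)))

module _ (p : ℕ) .{{_ : NonZero p}} (ℓ : ℕ) where
  open ≡-Reasoning

  ν≡ : ∀ j → ν p ℓ j ≡ j * a₀ p ℓ + (suc j * a p ℓ) / p
  ν≡ j = begin
      (A + j * ℓ) / p
    ≡⟨ cong (λ z → (A + j * z) / p) (m≡m%n+[m/n]*n ℓ p) ⟩
      (A + j * (A + A₀ * p)) / p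
    ≡⟨ cong (_/ p) (solve 4 (λ A j B P → A :+ j :* (A :+ B :* P) := (con 1 :+ j) :* A :+ (j :* B) :* P)
         refl A j A₀ p) ⟩
      (suc j * A + (j * A₀) * p) / p
    ≡⟨ [m+k*p]/p≡m/p+k p (suc j * A) (j * A₀) ⟩
      (suc j * A) / p + j * A₀
    ≡⟨ +-comm _ (j * A₀) ⟩
      j * A₀ + (suc j * A) / p ∎
    where
    A A₀ : ℕ
    A = a p ℓ
    A₀ = a₀ p ℓ

  ν-increment : ∀ i j → + ν p ℓ (i + j) - + ν p ℓ j
                      ≡ + (i * a₀ p ℓ + (i * a p ℓ) / p + carry p (i * a p ℓ) (suc j * a p ℓ))
  ν-increment i j = begin
      + ν p ℓ (i + j) - + ν p ℓ j
    ≡⟨ cong (λ z → + z - + ν p ℓ j) ν[i+j]≡ ⟩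
      + (δ + ν p ℓ j) - + ν p ℓ j
    ≡⟨ ℤ.[+m]-[+n]≡m⊖n (δ + ν p ℓ j) (ν p ℓ j) ⟩
      (δ + ν p ℓ j) ⊖ ν p ℓ j
    ≡⟨ ℤ.⊖-≥ (m≤n+m (ν p ℓ j) δ) ⟩
      + (δ + ν p ℓ j ∸ ν p ℓ j)
    ≡⟨ cong +_ (m+n∸n≡m δ (ν p ℓ j)) ⟩
      + δ ∎
    where
    A A₀ c δ : ℕ
    A = a p ℓ
    A₀ = a₀ p ℓ
    c = carry p (i * A) (suc j * A)
    δ = i * A₀ + (i * A) / p + c
    ν[i+j]≡ : ν p ℓ (i + j) ≡ δ + ν p ℓ j
    ν[i+j]≡ = begin
        ν p ℓ (i + j)
      ≡⟨ ν≡ (i + j) ⟩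
        (i + j) * A₀ + (suc (i + j) * A) / p
      ≡⟨ cong (λ z → (i + j) * A₀ + (z * A) / p) (+-suc i j) ⟨
        (i + j) * A₀ + ((i + suc j) * A) / p
      ≡⟨ cong (λ z → (i + j) * A₀ + z / p) (*-distribʳ-+ A i (suc j)) ⟩
        (i + j) * A₀ + (i * A + suc j * A) / p
      ≡⟨ cong (_+_ ((i + j) * A₀)) (/-distrib-+-carry p (i * A) (suc j * A)) ⟩
        (i + j) * A₀ + ((i * A) / p + (suc j * A) / p + c)
      ≡⟨ solve 6 (λ i j B x y z → (i :+ j) :* B :+ (x :+ y :+ z) := (i :* B :+ x :+ z) :+ (j :* B :+ y))
           refl i j A₀ ((i * A) / p) ((suc j * A) / p) c ⟩
        δ + (j * A₀ + (suc j * A) / p)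
      ≡⟨ cong (_+_ δ) (ν≡ j) ⟨
        δ + ν p ℓ j ∎

  nn≡ : ∀ i c → 0 < p ∸ i →
    (∀ {j} → j < p ∸ i → c ≤ carry p (i * a p ℓ) (suc j * a p ℓ)) →
    (∃ λ j → j < p ∸ i × carry p (i * a p ℓ) (suc j * a p ℓ) ≡ c) →
    nn p ℓ i ≡ + (i * a₀ p ℓ + (i * a p ℓ) / p + c)
  nn≡ i c 0<h lower (j , j<h , attained) =
    foldr-⊓-attains (λ j → + ν p ℓ (i + j) - + ν p ℓ j) (upTo (p ∸ i))
      (bound 0<h) (All.applyUpTo⁺₁ (λ j → j) (p ∸ i) bound)
      (Any.applyUpTo⁺ (λ j → j) (trans (ν-increment i j) (cong (λ z → + (base + z)) attained)) j<h)
    where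
    base : ℕ
    base = i * a₀ p ℓ + (i * a p ℓ) / p
    bound : ∀ {j} → j < p ∸ i → + (base + c) ≤ℤ + ν p ℓ (i + j) - + ν p ℓ j
    bound {j} j<h = subst (+ (base + c) ≤ℤ_) (sym (ν-increment i j)) (+≤+ (+-monoʳ-≤ base (lower j<h)))

module _ (p : ℕ) .{{_ : NonZero p}} (p-prime : Prime p) (ℓ : ℕ) (a≢0 : a p ℓ ≢ 0) where
  open MultiplesModPrime p p-prime (a p ℓ) (0<m<n⇒n∤m (n≢0⇒n>0 a≢0) (m%n<n ℓ p))

  InE⇒carries≡1 : ∀ {i h} → i + h ≡ p → InE p ℓ h →
    ∀ {j} → j < h → carry p (i * a p ℓ) (suc j * a p ℓ) ≡ 1
  InE⇒carries≡1 {i} {h} i+h≡p (1≤h , h<p , minimal) {j} j<h = carry≡1 p (i * A) (suc j * A) p≤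
    where
    A : ℕ
    A = a p ℓ
    complement : (i * A) % p + (h * A) % p ≡ p
    complement = [i*a]%p+[h*a]%p≡p i+h≡p 1≤h h<p
    p≤ : p ≤ (i * A) % p + (suc j * A) % p
    p≤ with m≤n⇒m<n∨m≡n j<h
    ... | inj₁ 1+j<h = subst (_≤ (i * A) % p + (suc j * A) % p) complement
                         (+-monoʳ-≤ ((i * A) % p) (<⇒≤ (minimal (suc j) (s≤s z≤n) 1+j<h)))
    ... | inj₂ refl = ≤-reflexive (sym complement)

  residue≤? : ∀ h m → Dec (1 ≤ m × (m * a p ℓ) % p ≤ (h * a p ℓ) % p)
  residue≤? h m = (1 ≤? m) ×-dec ((m * a p ℓ) % p ≤? (h * a p ℓ) % p)

  ¬InE⇒carry≡0 : ∀ {i h} → i + h ≡ p → 0 < h → ¬ InE p ℓ h →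
    ∃ λ j → j < h × carry p (i * a p ℓ) (suc j * a p ℓ) ≡ 0
  ¬InE⇒carry≡0 {zero} refl 0<p _ = 0 , 0<p , carry≡0 p 0 (1 * a p ℓ)
    (subst (λ z → z + (1 * a p ℓ) % p < p) (sym (m*n%n≡0 0 p)) (m%n<n (1 * a p ℓ) p))
  ¬InE⇒carry≡0 {suc i} {h} i+h≡p 0<h ¬InE
    with anyUpTo? (residue≤? h) h | subst (h <_) i+h≡p (m<n+m h z<s)
  ... | no none | h<p = contradiction
      (0<h , h<p , λ m 1≤m m<h → ≰⇒> (λ r[m]≤r[h] → none (m , m<h , 1≤m , r[m]≤r[h])))
      ¬InE
  ... | yes (suc j , 1+j<h , _ , r[1+j]≤r[h]) | h<p =
      j , <⇒≤ 1+j<h , carry≡0 p (suc i * A) (suc j * A) sum<p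
    where
    A : ℕ
    A = a p ℓ
    sum<p : (suc i * A) % p + (suc j * A) % p < p
    sum<p = subst ((suc i * A) % p + (suc j * A) % p <_) ([i*a]%p+[h*a]%p≡p i+h≡p 0<h h<p)
      (+-monoʳ-< ((suc i * A) % p) (≤∧≢⇒< r[1+j]≤r[h] ([m*a]%p≢[h*a]%p 1+j<h h<p)))

-- The parity hypotheses only make ℓ = (p + t)/2 the paper's integer; the identity holds for every ℓ.
lemma7p2 : (p : ℕ) .{{_ : NonZero p}} → Prime p → ¬ (p % 2 ≡ 0) →
    (t : ℕ) → t % 2 ≡ 1 →
    let ℓ = (p + t) / 2 in
    ¬ (a p ℓ ≡ 0) →
    (i : ℕ) → i ≤ p ∸ 1 →
      (InE p ℓ (p ∸ i) → nn p ℓ i ≡ + (i * a₀ p ℓ + (i * a p ℓ) / p + 1))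
      × (¬ InE p ℓ (p ∸ i) → nn p ℓ i ≡ + (i * a₀ p ℓ + (i * a p ℓ) / p))
lemma7p2 p p-prime _ t _ a≢0 i i≤p-1 = inE , notInE
  where
  ℓ : ℕ
  ℓ = (p + t) / 2
  i<p : i < p
  i<p = m≤pred[n]⇒suc[m]≤n i≤p-1
  0<h : 0 < p ∸ i
  0<h = m<n⇒0<n∸m i<p
  i+h≡p : i + (p ∸ i) ≡ p
  i+h≡p = m+[n∸m]≡n (<⇒≤ i<p)
  inE : InE p ℓ (p ∸ i) → nn p ℓ i ≡ + (i * a₀ p ℓ + (i * a p ℓ) / p + 1)
  inE h∈E = nn≡ p ℓ i 1 0<h (λ j<h → ≤-reflexive (sym (carries≡1 j<h))) (0 , 0<h , carries≡1 0<h)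
    where
    carries≡1 : ∀ {j} → j < p ∸ i → carry p (i * a p ℓ) (suc j * a p ℓ) ≡ 1
    carries≡1 = InE⇒carries≡1 p p-prime ℓ a≢0 i+h≡p h∈E
  notInE : ¬ InE p ℓ (p ∸ i) → nn p ℓ i ≡ + (i * a₀ p ℓ + (i * a p ℓ) / p)
  notInE h∉E = trans (nn≡ p ℓ i 0 0<h (λ _ → z≤n) (¬InE⇒carry≡0 p p-prime ℓ a≢0 i+h≡p 0<h h∉E))
                     (cong +_ (+-identityʳ _))
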